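{- Let $a,m\in\mathbb N$ with $m\le a+1$. Then the number of arcs of the Jaco graph $J_m(a)$ is $\frac12 m(m-1)$.
   Context: For $a\in\mathbb N$, the infinite Jaco graph $J_\infty(a)$ is the directed graph with vertex set $\{v_i:i\in\mathbb N\}$ in which every arc has the form $(v_i,v_j)$ with $i<j$, and for $i<j$, $(v_i,v_j)$ is an arc iff $(a+1)i-d^-(v_i)\ge j$, where $d^-(v_i)$ is the in-degree of $v_i$ (determined recursively). For $m\in\mathbb N$, the finite Jaco graph $J_m(a)$ is the subgraph of $J_\infty(a)$ induced on $\{v_1,\dots,v_m\}$. -}

module Defs where

open import Data.Nat using (ℕ; zero; suc; _+_; _*_; _∸_; _≤_; _<_; _≤?_; _<?_; _≤ᵇ_; _≡ᵇ_)
open import Data.Bool using (if_then_else_)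
open import Data.List using (List; []; _∷_; map; upTo; filter; length; concatMap)
open import Data.Product using (_×_; _,_; proj₁; proj₂)
open import Relation.Nullary using (Dec)
open import Relation.Nullary.Decidable using (_×-dec_)

-- Vertices v_i are indexed by positive naturals i = 1, 2, 3, ...

range1 : ℕ → List ℕ
range1 k = map suc (upTo k)

-- Given the in-degree function t (valid on indices < j), the in-degree of v_j:
-- the number of i with 1 ≤ i < j and (a+1)i - d⁻(v_i) ≥ j.
-- (Subtraction is truncated, but d⁻(v_i) ≤ i - 1 so it never truncates.)
inDegFrom : ℕ → (ℕ → ℕ) → ℕ → ℕ
inDegFrom a t j = length (filter (λ i → j ≤? (a + 1) * i ∸ t i) (range1 (j ∸ 1)))

-- degTable a n i = d⁻(v_i) in J_∞(a) for 1 ≤ i ≤ n (and 0 otherwise);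
-- the recursive definition of the in-degrees, built up vertex by vertex.
degTable : ℕ → ℕ → (ℕ → ℕ)
degTable a zero = λ _ → 0
degTable a (suc n) = λ i →
  if i ≤ᵇ n then degTable a n i
  else (if i ≡ᵇ suc n then inDegFrom a (degTable a n) (suc n) else 0)

inDeg : ℕ → ℕ → ℕ
inDeg a i = degTable a i i

Arc : ℕ → ℕ → ℕ → Set
Arc a i j = (i < j) × (j ≤ (a + 1) * i ∸ inDeg a i)

arc? : (a i j : ℕ) → Dec (Arc a i j)
arc? a i j = (i <? j) ×-dec (j ≤? (a + 1) * i ∸ inDeg a i)

pairs : ℕ → List (ℕ × ℕ)
pairs m = concatMap (λ j → map (λ i → (i , j)) (range1 (j ∸ 1))) (range1 m)

-- Number of arcs of the finite Jaco graph J_m(a)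
-- (the subgraph of J_∞(a) induced on {v_1, ..., v_m}).
arcCount : ℕ → ℕ → ℕ
arcCount a m = length (filter (λ p → arc? a (proj₁ p) (proj₂ p)) (pairs m))

-- Since v_i has at most i − 1 in-neighbours, it sends arcs to every v_j with
-- i < j ≤ (a + 1) i − (i − 1) = a i + 1, and a i + 1 ≥ a + 1 ≥ m.  So every pair
-- i < j ≤ m is an arc: J_m(a) is the transitive tournament on m vertices.
module Submission where

open import Defs
open import Data.Nat using (ℕ; _≤_; _+_; _*_; _∸_)
open import Relation.Binary.PropositionalEquality using (_≡_)

open import Data.Nat using (zero; suc; _<_; s<s; _<ᵇ_; _≡ᵇ_)
open import Data.Nat.Properties
open import Data.Nat.Tactic.RingSolver using (solve-∀)
open import Data.Bool using (true; false)
open import Data.List using ([]; [_]; _++_; map; upTo; length; concatMap)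
open import Data.List.Properties
  using (length-map; length-upTo; length-filter; length-++; map-++; concatMap-++;
         ++-identityʳ; upTo-∷ʳ; filter-all)
open import Data.List.Relation.Unary.All using (All)
open import Data.List.Relation.Unary.All.Properties using (map⁺; concat⁺; applyUpTo⁺₁)
open import Data.Product using (_×_; _,_)
open import Function using (id)
open import Relation.Binary.PropositionalEquality using (refl; sym; trans; cong; module ≡-Reasoning)

length-range1 : ∀ n → length (range1 n) ≡ n
length-range1 n = trans (length-map suc (upTo n)) (length-upTo n)

range1-suc : ∀ n → range1 (suc n) ≡ range1 n ++ [ suc n ]
range1-suc n = trans (cong (map suc) (sym (upTo-∷ʳ n))) (map-++ suc (upTo n) [ n ])

All-range1 : ∀ {p} {P : ℕ → Set p} n → (∀ {k} → k < n → P (suc k)) → All P (range1 n)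
All-range1 n Pk = map⁺ (applyUpTo⁺₁ id n Pk)

All-pairs : ∀ {p} {P : ℕ × ℕ → Set p} m →
  (∀ {k l} → k < l → l < m → P (suc k , suc l)) → All P (pairs m)
All-pairs m P = concat⁺ (map⁺ (All-range1 m λ l<m → map⁺ (All-range1 _ λ k<l → P k<l l<m)))

length-pairs-suc : ∀ m → length (pairs (suc m)) ≡ length (pairs m) + m
length-pairs-suc m = begin
  length (pairs (suc m))                       ≡⟨ cong (λ js → length (concatMap row js)) (range1-suc m) ⟩
  length (concatMap row (range1 m ++ [ suc m ])) ≡⟨ cong length (concatMap-++ row (range1 m) [ suc m ]) ⟩
  length (pairs m ++ row (suc m) ++ [])         ≡⟨ length-++ (pairs m) ⟩
  length (pairs m) + length (row (suc m) ++ [])  ≡⟨ cong (λ xs → length (pairs m) + length xs) (++-identityʳ (row (suc m))) ⟩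
  length (pairs m) + length (row (suc m))       ≡⟨ cong (length (pairs m) +_) (trans (length-map _ (range1 m)) (length-range1 m)) ⟩
  length (pairs m) + m                          ∎
  where
  open ≡-Reasoning
  row = λ j → map (λ i → (i , j)) (range1 (j ∸ 1))

twice-length-pairs : ∀ m → 2 * length (pairs m) ≡ m * (m ∸ 1)
twice-length-pairs zero = refl
twice-length-pairs (suc m) = begin
  2 * length (pairs (suc m))    ≡⟨ cong (2 *_) (length-pairs-suc m) ⟩
  2 * (length (pairs m) + m)    ≡⟨ *-distribˡ-+ 2 (length (pairs m)) m ⟩
  2 * length (pairs m) + 2 * m  ≡⟨ cong (_+ 2 * m) (twice-length-pairs m) ⟩
  m * (m ∸ 1) + 2 * m           ≡⟨ gauss-step m ⟩
  suc m * m                     ∎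
  where
  open ≡-Reasoning
  gauss-step : ∀ m → m * (m ∸ 1) + 2 * m ≡ suc m * m
  gauss-step zero = refl
  gauss-step (suc k) = expand k
    where
    expand : ∀ k → suc k * k + 2 * suc k ≡ suc (suc k) * suc k
    expand = solve-∀

<ᵇ-irrefl : ∀ n → (n <ᵇ n) ≡ false
<ᵇ-irrefl zero = refl
<ᵇ-irrefl (suc n) = <ᵇ-irrefl n

≡ᵇ-refl : ∀ n → (n ≡ᵇ n) ≡ true
≡ᵇ-refl zero = refl
≡ᵇ-refl (suc n) = ≡ᵇ-refl n

-- The rewrites pick the freshly computed last row of degTable: suc n ≤ᵇ n is n <ᵇ n.
inDeg-suc-≤ : ∀ a n → inDeg a (suc n) ≤ n
inDeg-suc-≤ a n rewrite <ᵇ-irrefl n | ≡ᵇ-refl n =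
  ≤-trans (length-filter _ (range1 n)) (≤-reflexive (length-range1 n))

Arc-below : ∀ a k j → suc k < j → j ≤ a + 1 → Arc a (suc k) j
Arc-below a k j k<j j≤a+1 = k<j , (begin
  j                                   ≤⟨ j≤a+1 ⟩
  a + 1                               ≤⟨ +-monoˡ-≤ 1 (m≤m*n a (suc k)) ⟩
  a * suc k + 1                       ≡⟨ sym (m+n∸n≡m (a * suc k + 1) k) ⟩
  a * suc k + 1 + k ∸ k               ≡⟨ cong (_∸ k) (expand a k) ⟩
  (a + 1) * suc k ∸ k                 ≤⟨ ∸-monoʳ-≤ ((a + 1) * suc k) (inDeg-suc-≤ a k) ⟩
  (a + 1) * suc k ∸ inDeg a (suc k)   ∎)
  where
  open ≤-Reasoning
  expand : ∀ a k → a * suc k + 1 + k ≡ (a + 1) * suc k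
  expand = solve-∀

arcCount-complete : ∀ a m → m ≤ a + 1 → arcCount a m ≡ length (pairs m)
arcCount-complete a m m≤a+1 = cong length (filter-all _ (All-pairs m λ {k} {l} k<l l<m →
  Arc-below a k (suc l) (s<s k<l) (≤-trans l<m m≤a+1)))

proposition3p1 : (a m : ℕ) → 1 ≤ a → 1 ≤ m → m ≤ a + 1 →
    2 * arcCount a m ≡ m * (m ∸ 1)
proposition3p1 a m _ _ m≤a+1 =
  trans (cong (2 *_) (arcCount-complete a m m≤a+1)) (twice-length-pairs m)
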